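{- Let $\mathcal{C}$ be a simplicial complex on ground set $[m]$ and $\mathbf{d}=(d_1,\dots,d_m)$ an integer vector with all $d_i\ge2$, and assume $\mathcal{A}_{\mathcal{C},\mathbf{d}}$ is normal. Let $v$ be a vertex of $\mathcal{C}$ and let $\mathbf{d}'$ be obtained from $\mathbf{d}$ by deleting $d_v$. Then $\mathcal{A}_{\mathrm{link}_v(\mathcal{C}),\mathbf{d}'}$ is normal.
   Context: The matrix $\mathcal{A}_{\mathcal{C},\mathbf{d}}$ has columns indexed by $\mathbf{i}\in\prod_{j\in[m]}[d_j]$ and rows indexed by pairs $(F,e)$ with $F$ a facet (inclusion-maximal face) of $\mathcal{C}$ and $e\in\prod_{j\in F}[d_j]$; the entry in row $(F,e)$, column $\mathbf{i}$ is $1$ if $e=(i_j:j\in F)$ and $0$ otherwise. A matrix $A$ with $n$ columns is normal if $\mathbb{R}_{\ge0}A\cap\mathbb{Z}A=\mathbb{N}A$ (cone, lattice and semigroup generated by the columns). The link of a vertex $v$ is $\mathrm{link}_v(\mathcal{C})=\{F\setminus\{v\}: F\in\mathcal{C},\ v\in F\}$, regarded as a complex on ground set $[m]\setminus\{v\}$.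
   Formalization: The cone $\mathbb{R}_{\ge0}A$ in the definition of normality is replaced by the cone of nonnegative rational combinations of the columns. -}

module Defs where

open import Data.Nat using (ℕ; zero; suc)
open import Data.Bool using (Bool; true; false; _∧_; if_then_else_)
open import Data.Fin using (Fin; zero; suc; punchIn)
import Data.Fin as Fin
open import Data.Fin.Subset using (Subset; _∈_; _⊆_; ⁅_⁆; inside)
open import Data.Fin.Subset.Properties using (_∈?_)
open import Data.Integer using (ℤ; +_)
import Data.Integer as ℤ
open import Data.Rational using (ℚ; 0ℚ; _≤_)
import Data.Rational as ℚ
open import Data.List using (List; []; _∷_; map; foldr; concatMap; allFin)
open import Data.Product using (Σ; _×_; _,_)
open import Data.Vec using (insertAt)
open import Relation.Binary.PropositionalEquality using (_≡_)
open import Relation.Nullary using (yes; no)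
open import Relation.Nullary.Decidable using (⌊_⌋)

Complex : ℕ → Set
Complex m = Subset m → Bool

IsSimplicialComplex : ∀ {m} → Complex m → Set
IsSimplicialComplex {m} C = ∀ (F G : Subset m) → G ⊆ F → C F ≡ true → C G ≡ true

IsFacet : ∀ {m} → Complex m → Subset m → Set
IsFacet {m} C F = (C F ≡ true) × (∀ (G : Subset m) → F ⊆ G → C G ≡ true → G ⊆ F)

Col : ∀ {m} → (Fin m → ℕ) → Set
Col {m} d = (j : Fin m) → Fin (d j)

allCols : ∀ m (d : Fin m → ℕ) → List (Col d)
allCols zero d = (λ ()) ∷ []
allCols (suc m) d =
  concatMap (λ a → map (λ r → cons a r) (allCols m (λ j → d (suc j)))) (allFin (d zero))
  where
  cons : Fin (d zero) → Col (λ j → d (suc j)) → Col d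
  cons a r zero = a
  cons a r (suc j) = r j

Row : ∀ {m} → Complex m → (Fin m → ℕ) → Set
Row {m} C d = Σ (Subset m) λ F → IsFacet C F × ((j : Fin m) → j ∈ F → Fin (d j))

agrees : ∀ {m} {d : Fin m → ℕ} (F : Subset m) → ((j : Fin m) → j ∈ F → Fin (d j)) → Col d → Bool
agrees {m} F e i = foldr (λ j b → test j ∧ b) true (allFin m)
  where
  test : Fin m → Bool
  test j with j ∈? F
  ... | yes p = ⌊ e j p Fin.≟ i j ⌋
  ... | no _  = true

matA : ∀ {m} (C : Complex m) (d : Fin m → ℕ) → Row C d → Col d → ℤ
matA C d (F , _ , e) i = if agrees F e i then + 1 else + 0

sumℤ : List ℤ → ℤ
sumℤ = foldr ℤ._+_ (+ 0)

sumℚ : List ℚ → ℚ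
sumℚ = foldr ℚ._+_ 0ℚ

toℚ : ℤ → ℚ
toℚ z = z ℚ./ 1

InLattice : {R I : Set} → List I → (R → I → ℤ) → (R → ℤ) → Set
InLattice {R} {I} cols A x =
  Σ (I → ℤ) λ c → ∀ (r : R) → x r ≡ sumℤ (map (λ i → c i ℤ.* A r i) cols)

-- x ∈ ℝ≥0 A (via nonnegative rational coefficients)
InCone : {R I : Set} → List I → (R → I → ℤ) → (R → ℤ) → Set
InCone {R} {I} cols A x =
  Σ (I → ℚ) λ c → (∀ i → 0ℚ ≤ c i) ×
    (∀ (r : R) → toℚ (x r) ≡ sumℚ (map (λ i → c i ℚ.* toℚ (A r i)) cols))

InSemigroup : {R I : Set} → List I → (R → I → ℤ) → (R → ℤ) → Set
InSemigroup {R} {I} cols A x =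
  Σ (I → ℕ) λ c → ∀ (r : R) → x r ≡ sumℤ (map (λ i → (+ c i) ℤ.* A r i) cols)

IsNormal : {R I : Set} → List I → (R → I → ℤ) → Set
IsNormal {R} cols A = ∀ (x : R → ℤ) → InLattice cols A x → InCone cols A x → InSemigroup cols A x

NormalA : ∀ {m} (C : Complex m) (d : Fin m → ℕ) → Set
NormalA {m} C d = IsNormal (allCols m d) (matA C d)

-- link_v(C) on ground set [m] ∖ {v}, identified with Fin n via punchIn v:
-- G ∈ link iff G ∪ {v} ∈ C.
link : ∀ {n} → Complex (suc n) → Fin (suc n) → Complex n
link C v G = C (insertAt G v inside)

deleteAt : ∀ {n} → (Fin (suc n) → ℕ) → Fin (suc n) → (Fin n → ℕ)
deleteAt d v j = d (punchIn v j)

-- Let x = A_link c with c integral and x = A_link q with q ≥ 0 rational. Fix two values a₀ ≠ a₁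
-- of the v-th coordinate (d_v ≥ 2) and an integral vector P ≥ q. The lift of a coefficient vector u
-- of the link puts u on the columns with i_v = a₀, P − u on those with i_v = a₁ and 0 elsewhere.
-- The facets of C through v are the sets G ∪ {v} for facets G of the link, and a row (G ∪ {v}, e)
-- sees the lift of u only on the slice i_v = e_v, through A_link u and A_link P; a row whose facet
-- avoids v sees only the sum over i_v, which is P. Hence A_C (lift c) = A_C (lift q) lies in the
-- lattice and in the cone of A_C, so by normality it is A_C N for some N ≥ 0, and on the rows
-- (G ∪ {v}, e) with e_v = a₀ this reads x = A_link (N restricted to the slice i_v = a₀).

module Submission where

open import Defs
open import Algebra.Bundles using (CommutativeRing)
open import Data.Bool using (Bool; true; false; _∧_; if_then_else_)
open import Data.Fin using (Fin; zero; suc; _≟_; punchIn)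
open import Data.Fin.Subset using (⁅_⁆)
open import Data.Integer using (+_)
open import Data.List using (List; []; _∷_; _++_; map; foldr; concatMap; allFin)
open import Data.List.Properties using (map-tabulate)
open import Data.List.Relation.Unary.All using (All; []; _∷_)
open import Data.Nat using (ℕ; suc; _≤_; s≤s)
open import Data.Product using (Σ-syntax; _,_; proj₁; proj₂)
open import Data.Rational using (↥_)
open import Function using (_∘_)
open import Level using (Level)
open import Relation.Binary.PropositionalEquality using (_≡_; _≢_)
import Relation.Binary.PropositionalEquality as ≡
open import Relation.Nullary using (yes; no; contradiction)
open import Relation.Nullary.Decidable using (does)

module ListSum {c ℓ : Level} (R : CommutativeRing c ℓ) where

  open CommutativeRing R hiding (zero)
  open import Algebra.Properties.AbelianGroup +-abelianGroup using (⁻¹-∙-comm)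
  open import Algebra.Properties.Group +-group using (ε⁻¹≈ε)
  open import Algebra.Properties.CommutativeSemigroup +-commutativeSemigroup using (x∙yz≈y∙xz)
  open import Relation.Binary.Reasoning.Setoid setoid

  ∑ : {I : Set} → List I → (I → Carrier) → Carrier
  ∑ xs f = foldr _+_ 0# (map f xs)

  syntax ∑ xs (λ i → e) = ∑[ i ∈ xs ] e

  𝟙 : Bool → Carrier
  𝟙 b = if b then 1# else 0#

  𝟙-∧ : ∀ x y → 𝟙 (x ∧ y) ≈ 𝟙 x * 𝟙 y
  𝟙-∧ false y = sym (zeroˡ (𝟙 y))
  𝟙-∧ true  y = sym (*-identityˡ (𝟙 y))

  module _ {I : Set} where

    ∑-congᴬ : ∀ {xs : List I} {f g : I → Carrier} → All (λ i → f i ≈ g i) xs → ∑ xs f ≈ ∑ xs g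
    ∑-congᴬ []       = refl
    ∑-congᴬ (p ∷ ps) = +-cong p (∑-congᴬ ps)

    ∑-cong : ∀ (xs : List I) {f g : I → Carrier} → (∀ i → f i ≈ g i) → ∑ xs f ≈ ∑ xs g
    ∑-cong []       f≈g = refl
    ∑-cong (x ∷ xs) f≈g = +-cong (f≈g x) (∑-cong xs f≈g)

    ∑-zero : ∀ (xs : List I) → ∑[ i ∈ xs ] 0# ≈ 0#
    ∑-zero []       = refl
    ∑-zero (x ∷ xs) = trans (+-identityˡ _) (∑-zero xs)

    ∑-++ : ∀ (xs ys : List I) (f : I → Carrier) → ∑ (xs ++ ys) f ≈ ∑ xs f + ∑ ys f
    ∑-++ []       ys f = sym (+-identityˡ _)
    ∑-++ (x ∷ xs) ys f = trans (+-congˡ (∑-++ xs ys f)) (sym (+-assoc _ _ _))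

    ∑-distrib-+ : ∀ (xs : List I) (f g : I → Carrier) → ∑[ i ∈ xs ] (f i + g i) ≈ ∑ xs f + ∑ xs g
    ∑-distrib-+ []       f g = sym (+-identityˡ _)
    ∑-distrib-+ (x ∷ xs) f g = begin
      (f x + g x) + ∑[ i ∈ xs ] (f i + g i) ≈⟨ +-congˡ (∑-distrib-+ xs f g) ⟩
      (f x + g x) + (∑ xs f + ∑ xs g)       ≈⟨ +-assoc _ _ _ ⟩
      f x + (g x + (∑ xs f + ∑ xs g))       ≈⟨ +-congˡ (x∙yz≈y∙xz (g x) (∑ xs f) (∑ xs g)) ⟩
      f x + (∑ xs f + (g x + ∑ xs g))       ≈⟨ +-assoc _ _ _ ⟨
      (f x + ∑ xs f) + (g x + ∑ xs g)       ∎

    neg-distrib-∑ : ∀ (xs : List I) (f : I → Carrier) → ∑[ i ∈ xs ] (- f i) ≈ - ∑ xs f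
    neg-distrib-∑ []       f = sym ε⁻¹≈ε
    neg-distrib-∑ (x ∷ xs) f = trans (+-congˡ (neg-distrib-∑ xs f)) (⁻¹-∙-comm (f x) (∑ xs f))

    *-distribˡ-∑ : ∀ (xs : List I) (k : Carrier) (f : I → Carrier) → k * ∑ xs f ≈ ∑[ i ∈ xs ] (k * f i)
    *-distribˡ-∑ []       k f = zeroʳ k
    *-distribˡ-∑ (x ∷ xs) k f = trans (distribˡ k _ _) (+-congˡ (*-distribˡ-∑ xs k f))

    *-distribʳ-∑ : ∀ (xs : List I) (k : Carrier) (f : I → Carrier) → ∑ xs f * k ≈ ∑[ i ∈ xs ] (f i * k)
    *-distribʳ-∑ []       k f = zeroˡ k
    *-distribʳ-∑ (x ∷ xs) k f = trans (distribʳ k _ _) (+-congˡ (*-distribʳ-∑ xs k f))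

  ∑-concatMap : ∀ {I J K : Set} (xs : List I) (ys : List J) (g : I → J → K) (f : K → Carrier) →
                ∑ (concatMap (λ x → map (g x) ys) xs) f ≈ ∑[ x ∈ xs ] ∑[ y ∈ ys ] f (g x y)
  ∑-concatMap []       ys g f = refl
  ∑-concatMap (x ∷ xs) ys g f = begin
    ∑ (map (g x) ys ++ concatMap (λ x → map (g x) ys) xs) f
      ≈⟨ ∑-++ (map (g x) ys) _ f ⟩
    ∑ (map (g x) ys) f + ∑ (concatMap (λ x → map (g x) ys) xs) f
      ≈⟨ +-cong (∑-map ys) (∑-concatMap xs ys g f) ⟩
    ∑[ y ∈ ys ] f (g x y) + ∑[ x ∈ xs ] ∑[ y ∈ ys ] f (g x y) ∎
    where
    ∑-map : ∀ ys → ∑ (map (g x) ys) f ≈ ∑[ y ∈ ys ] f (g x y)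
    ∑-map []       = refl
    ∑-map (y ∷ ys) = +-congˡ (∑-map ys)

  ∑-comm : ∀ {I J : Set} (xs : List I) (ys : List J) (f : I → J → Carrier) →
           ∑[ x ∈ xs ] ∑[ y ∈ ys ] f x y ≈ ∑[ y ∈ ys ] ∑[ x ∈ xs ] f x y
  ∑-comm []       ys f = sym (∑-zero ys)
  ∑-comm (x ∷ xs) ys f = begin
    ∑[ y ∈ ys ] f x y + ∑[ x ∈ xs ] ∑[ y ∈ ys ] f x y ≈⟨ +-congˡ (∑-comm xs ys f) ⟩
    ∑[ y ∈ ys ] f x y + ∑[ y ∈ ys ] ∑[ x ∈ xs ] f x y ≈⟨ ∑-distrib-+ ys (f x) _ ⟨
    ∑[ y ∈ ys ] (f x y + ∑[ x ∈ xs ] f x y)          ∎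

  ∑-allFin-suc : ∀ {k} (f : Fin (suc k) → Carrier) → ∑ (allFin (suc k)) f ≈ f zero + ∑ (allFin k) (f ∘ suc)
  ∑-allFin-suc f = reflexive (≡.cong (λ fs → f zero + foldr _+_ 0# fs)
    (≡.trans (map-tabulate suc f) (≡.sym (map-tabulate (λ b → b) (f ∘ suc)))))

  ∑-select : ∀ {k} (β : Fin k) (f : Fin k → Carrier) → ∑[ b ∈ allFin k ] (𝟙 (does (b ≟ β)) * f b) ≈ f β
  ∑-select {suc k} zero f = begin
    ∑[ b ∈ allFin (suc k) ] (𝟙 (does (b ≟ zero)) * f b)
      ≈⟨ ∑-allFin-suc (λ b → 𝟙 (does (b ≟ zero)) * f b) ⟩
    1# * f zero + ∑[ b ∈ allFin k ] (0# * f (suc b))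
      ≈⟨ +-cong (*-identityˡ _) (∑-cong (allFin k) (λ b → zeroˡ _)) ⟩
    f zero + ∑[ b ∈ allFin k ] 0#
      ≈⟨ +-congˡ (∑-zero (allFin k)) ⟩
    f zero + 0#
      ≈⟨ +-identityʳ _ ⟩
    f zero ∎
  ∑-select {suc k} (suc β) f = begin
    ∑[ b ∈ allFin (suc k) ] (𝟙 (does (b ≟ suc β)) * f b)
      ≈⟨ ∑-allFin-suc (λ b → 𝟙 (does (b ≟ suc β)) * f b) ⟩
    0# * f zero + ∑[ b ∈ allFin k ] (𝟙 (does (b ≟ β)) * f (suc b))
      ≈⟨ +-cong (zeroˡ _) (∑-select β (f ∘ suc)) ⟩
    0# + f (suc β)
      ≈⟨ +-identityˡ _ ⟩
    f (suc β) ∎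

module Split {c ℓ : Level} (R : CommutativeRing c ℓ) {k : ℕ} {a₀ a₁ : Fin k} (a₀≢a₁ : a₀ ≢ a₁) where

  open CommutativeRing R hiding (zero)
  open ListSum R
  open import Algebra.Properties.Ring ring using ([y-z]x≈yx-zx)
  open import Algebra.Properties.Group +-group using (//-rightDividesˡ)
  open import Relation.Binary.Reasoning.Setoid setoid

  split : Fin k → Carrier → Carrier → Carrier
  split b X P with b ≟ a₀ | b ≟ a₁
  ... | yes _ | _     = X
  ... | no _  | yes _ = P - X
  ... | no _  | no _  = 0#

  split-a₀ : ∀ X P → split a₀ X P ≡ X
  split-a₀ X P with a₀ ≟ a₀
  ... | yes _    = ≡.refl
  ... | no a₀≢a₀ = contradiction ≡.refl a₀≢a₀

  split-cong : ∀ b {X X′} P → X ≈ X′ → split b X P ≈ split b X′ P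
  split-cong b P X≈X′ with b ≟ a₀ | b ≟ a₁
  ... | yes _ | _     = X≈X′
  ... | no _  | yes _ = +-congˡ (-‿cong X≈X′)
  ... | no _  | no _  = refl

  split≈𝟙 : ∀ b X P → split b X P ≈ 𝟙 (does (b ≟ a₀)) * X + 𝟙 (does (b ≟ a₁)) * (P - X)
  split≈𝟙 b X P with b ≟ a₀ | b ≟ a₁
  ... | yes ≡.refl | yes b≡a₁ = contradiction b≡a₁ a₀≢a₁
  ... | yes _ | no _  = sym (trans (+-cong (*-identityˡ X) (zeroˡ _)) (+-identityʳ X))
  ... | no _  | yes _ = sym (trans (+-cong (zeroˡ X) (*-identityˡ _)) (+-identityˡ _))
  ... | no _  | no _  = sym (trans (+-cong (zeroˡ X) (zeroˡ _)) (+-identityˡ _))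

  ∑-split : ∀ X P → ∑[ b ∈ allFin k ] split b X P ≈ P
  ∑-split X P = begin
    ∑[ b ∈ allFin k ] split b X P
      ≈⟨ ∑-cong (allFin k) (λ b → split≈𝟙 b X P) ⟩
    ∑[ b ∈ allFin k ] (𝟙 (does (b ≟ a₀)) * X + 𝟙 (does (b ≟ a₁)) * (P - X))
      ≈⟨ ∑-distrib-+ (allFin k) _ _ ⟩
    ∑[ b ∈ allFin k ] (𝟙 (does (b ≟ a₀)) * X) + ∑[ b ∈ allFin k ] (𝟙 (does (b ≟ a₁)) * (P - X))
      ≈⟨ +-cong (∑-select a₀ (λ _ → X)) (∑-select a₁ (λ _ → P - X)) ⟩
    X + (P - X) ≈⟨ +-comm X (P - X) ⟩
    P - X + X   ≈⟨ //-rightDividesˡ X P ⟩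
    P           ∎

  ∑-split-* : ∀ {I : Set} (xs : List I) b (u P a : I → Carrier) →
              ∑[ i ∈ xs ] (split b (u i) (P i) * a i) ≈ split b (∑[ i ∈ xs ] (u i * a i)) (∑[ i ∈ xs ] (P i * a i))
  ∑-split-* xs b u P a with b ≟ a₀ | b ≟ a₁
  ... | yes _ | _     = refl
  ... | no _  | yes _ = begin
    ∑[ i ∈ xs ] ((P i - u i) * a i)              ≈⟨ ∑-cong xs (λ i → [y-z]x≈yx-zx (a i) (P i) (u i)) ⟩
    ∑[ i ∈ xs ] (P i * a i - u i * a i)          ≈⟨ ∑-distrib-+ xs _ _ ⟩
    ∑[ i ∈ xs ] (P i * a i) + ∑[ i ∈ xs ] (- (u i * a i)) ≈⟨ +-congˡ (neg-distrib-∑ xs (λ i → u i * a i)) ⟩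
    ∑[ i ∈ xs ] (P i * a i) - ∑[ i ∈ xs ] (u i * a i) ∎
  ... | no _  | no _  = trans (∑-cong xs (λ i → zeroˡ (a i))) (∑-zero xs)

module Columns where

  open import Data.List.Relation.Unary.All using (universal)
  import Data.List.Relation.Unary.All as All
  open import Data.List.Relation.Unary.All.Properties using (concat⁺; map⁺)
  open ≡ using (refl; cong; cong₂)

  -- `allCols` builds columns with a function local to its `where` block; it is named by unification.
  private
    allCols-zero : (d : Fin 0 → ℕ) → Σ[ e ∈ Col d ] allCols 0 d ≡ e ∷ []
    allCols-zero d = _ , refl

    allCols-suc : ∀ {m} (d : Fin (suc m) → ℕ) →
                  Σ[ cons ∈ (Fin (d zero) → Col (d ∘ suc) → Col d) ]
                    allCols (suc m) d ≡ concatMap (λ a → map (cons a) (allCols m (d ∘ suc))) (allFin (d zero))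
    allCols-suc d = _ , refl

  emptyCol : (d : Fin 0 → ℕ) → Col d
  emptyCol d = proj₁ (allCols-zero d)

  consCol : ∀ {m} (d : Fin (suc m) → ℕ) → Fin (d zero) → Col (d ∘ suc) → Col d
  consCol d = proj₁ (allCols-suc d)

  insertCol : ∀ {n} (d : Fin (suc n) → ℕ) (v : Fin (suc n)) → Fin (d v) → Col (deleteAt d v) → Col d
  insertCol d zero a i = consCol d a i
  insertCol {suc n} d (suc v) a i = consCol d (i zero) (insertCol (d ∘ suc) v a (λ k → i (suc k)))

  deleteCol : ∀ {n} {d : Fin (suc n) → ℕ} (v : Fin (suc n)) → Col d → Col (deleteAt d v)
  deleteCol v j k = j (punchIn v k)

  insertCol-self : ∀ {n} (d : Fin (suc n) → ℕ) v a (i : Col (deleteAt d v)) → insertCol d v a i v ≡ a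
  insertCol-self d zero a i = refl
  insertCol-self {suc n} d (suc v) a i = insertCol-self (d ∘ suc) v a (λ k → i (suc k))

  insertCol-punchIn : ∀ {n} (d : Fin (suc n) → ℕ) v a (i : Col (deleteAt d v)) k →
                      insertCol d v a i (punchIn v k) ≡ i k
  insertCol-punchIn d zero a i k = refl
  insertCol-punchIn {suc n} d (suc v) a i zero = refl
  insertCol-punchIn {suc n} d (suc v) a i (suc k) = insertCol-punchIn (d ∘ suc) v a (λ k → i (suc k)) k

  -- Columns are functions, so pointwise equal columns need not be equal; `canonical` rebuilds a
  -- column from its values and agrees with the identity on the enumerated columns.
  canonical : ∀ {m} {d : Fin m → ℕ} → Col d → Col d
  canonical {0}       {d} j = emptyCol d
  canonical {suc m} {d} j = consCol d (j zero) (canonical (λ k → j (suc k)))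

  canonical-cong : ∀ {m} {d : Fin m → ℕ} {j j′ : Col d} → (∀ k → j k ≡ j′ k) → canonical j ≡ canonical j′
  canonical-cong {0}       j≗j′ = refl
  canonical-cong {suc m} {d} j≗j′ = cong₂ (consCol d) (j≗j′ zero) (canonical-cong (λ k → j≗j′ (suc k)))

  canonical-allCols : ∀ m (d : Fin m → ℕ) → All (λ j → canonical j ≡ j) (allCols m d)
  canonical-allCols 0         d = refl ∷ []
  canonical-allCols (suc m) d =
    concat⁺ (map⁺ (universal (λ a → map⁺ (All.map (cong (consCol d a)) (canonical-allCols m (d ∘ suc)))) (allFin (d zero))))

  canonical-deleteCol-insertCol : ∀ {n} (d : Fin (suc n) → ℕ) v a (i : Col (deleteAt d v)) →
                                  canonical (deleteCol v (insertCol d v a i)) ≡ canonical i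
  canonical-deleteCol-insertCol d v a i = canonical-cong (insertCol-punchIn d v a i)

module ColumnSum {c ℓ : Level} (R : CommutativeRing c ℓ) where

  open CommutativeRing R hiding (zero)
  open ListSum R
  open Columns
  open import Algebra.Properties.CommutativeSemigroup *-commutativeSemigroup using (x∙yz≈y∙xz)
  open import Relation.Binary.Reasoning.Setoid setoid

  ∑-allCols-insertCol : ∀ n (d : Fin (suc n) → ℕ) (v : Fin (suc n)) (f : Col d → Carrier) →
    ∑ (allCols (suc n) d) f ≈ ∑[ b ∈ allFin (d v) ] ∑[ i ∈ allCols n (deleteAt d v) ] f (insertCol d v b i)
  ∑-allCols-insertCol n d zero f = ∑-concatMap (allFin (d zero)) (allCols n (d ∘ suc)) (consCol d) f
  ∑-allCols-insertCol (suc n) d (suc v) f = begin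
    ∑ (allCols (suc (suc n)) d) f
      ≈⟨ ∑-concatMap (allFin (d zero)) (allCols (suc n) d₁) (consCol d) f ⟩
    ∑[ a ∈ allFin (d zero) ] ∑[ j ∈ allCols (suc n) d₁ ] f (consCol d a j)
      ≈⟨ ∑-cong (allFin (d zero)) (λ a → ∑-allCols-insertCol n d₁ v (f ∘ consCol d a)) ⟩
    ∑[ a ∈ allFin (d zero) ] ∑[ b ∈ allFin (d (suc v)) ] ∑[ i ∈ cols′ ] f (consCol d a (insertCol d₁ v b i))
      ≈⟨ ∑-comm (allFin (d zero)) (allFin (d (suc v))) _ ⟩
    ∑[ b ∈ allFin (d (suc v)) ] ∑[ a ∈ allFin (d zero) ] ∑[ i ∈ cols′ ] f (consCol d a (insertCol d₁ v b i))
      ≈⟨ ∑-cong (allFin (d (suc v)))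
                (λ b → ∑-concatMap (allFin (d zero)) cols′ (consCol (deleteAt d (suc v))) (f ∘ insertCol d (suc v) b)) ⟨
    ∑[ b ∈ allFin (d (suc v)) ] ∑[ i ∈ allCols (suc n) (deleteAt d (suc v)) ] f (insertCol d (suc v) b i) ∎
    where
    d₁ = d ∘ suc
    cols′ = allCols n (deleteAt d₁ v)

  ∑-slice : ∀ {n} (d : Fin (suc n) → ℕ) v (hit : Col d → Bool) (hit′ : Col (deleteAt d v) → Bool) β →
            (∀ b i → hit (insertCol d v b i) ≡ (does (b ≟ β) ∧ hit′ i)) → ∀ (w : Col d → Carrier) →
            ∑[ j ∈ allCols (suc n) d ] (w j * 𝟙 (hit j)) ≈
            ∑[ i ∈ allCols n (deleteAt d v) ] (w (insertCol d v β i) * 𝟙 (hit′ i))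
  ∑-slice {n} d v hit hit′ β hit≡ w = begin
    ∑[ j ∈ allCols (suc n) d ] (w j * 𝟙 (hit j))
      ≈⟨ ∑-allCols-insertCol n d v _ ⟩
    ∑[ b ∈ allFin (d v) ] ∑[ i ∈ cols′ ] (w (insertCol d v b i) * 𝟙 (hit (insertCol d v b i)))
      ≈⟨ ∑-cong (allFin (d v)) (λ b → ∑-cong cols′ (λ i → *-congˡ (reflexive (≡.cong 𝟙 (hit≡ b i))))) ⟩
    ∑[ b ∈ allFin (d v) ] ∑[ i ∈ cols′ ] (w (insertCol d v b i) * 𝟙 (does (b ≟ β) ∧ hit′ i))
      ≈⟨ ∑-cong (allFin (d v)) (λ b → ∑-cong cols′ (λ i →
           trans (*-congˡ (𝟙-∧ (does (b ≟ β)) (hit′ i))) (x∙yz≈y∙xz _ _ _))) ⟩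
    ∑[ b ∈ allFin (d v) ] ∑[ i ∈ cols′ ] (𝟙 (does (b ≟ β)) * (w (insertCol d v b i) * 𝟙 (hit′ i)))
      ≈⟨ ∑-cong (allFin (d v)) (λ b → *-distribˡ-∑ cols′ _ _) ⟨
    ∑[ b ∈ allFin (d v) ] (𝟙 (does (b ≟ β)) * ∑[ i ∈ cols′ ] (w (insertCol d v b i) * 𝟙 (hit′ i)))
      ≈⟨ ∑-select β _ ⟩
    ∑[ i ∈ cols′ ] (w (insertCol d v β i) * 𝟙 (hit′ i)) ∎
    where
    cols′ = allCols n (deleteAt d v)

module Agreement where

  open import Data.Fin.Subset using (Subset; _∈_)
  open import Data.Fin.Subset.Properties using (_∈?_)
  open import Data.List.Relation.Unary.All.Properties using (tabulate⁺; tabulate⁻)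
  open import Data.Product using (_×_)
  open import Data.Vec.Properties.WithK using ([]=-irrelevant)
  open import Relation.Nullary using (proof)
  open import Relation.Nullary.Decidable using (isYes≗does)
  open import Relation.Nullary.Reflects using (Reflects; ofʸ; ofⁿ; _×-reflects_)
  open ≡ using (refl; cong; subst; trans)

  Reflects-map : ∀ {A B : Set} {b} → (A → B) → (B → A) → Reflects A b → Reflects B b
  Reflects-map A→B B→A (ofʸ a)  = ofʸ (A→B a)
  Reflects-map A→B B→A (ofⁿ ¬a) = ofⁿ (¬a ∘ B→A)

  foldr-∧-reflects : ∀ {A : Set} {P : A → Set} {t : A → Bool} → (∀ x → Reflects (P x) (t x)) →
                     ∀ xs → Reflects (All P xs) (foldr (λ x b → t x ∧ b) true xs)
  foldr-∧-reflects P? []       = ofʸ []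
  foldr-∧-reflects P? (x ∷ xs) =
    Reflects-map (λ (p , ps) → p ∷ ps) (λ { (p ∷ ps) → p , ps }) (P? x ×-reflects foldr-∧-reflects P? xs)

  ∈-irrelevant-app : ∀ {m} {A : Fin m → Set} {F : Subset m} (e : ∀ j → j ∈ F → A j) {j} (p q : j ∈ F) → e j p ≡ e j q
  ∈-irrelevant-app e p q = cong (e _) ([]=-irrelevant p q)

  Agrees : ∀ {m} {d : Fin m → ℕ} (F : Subset m) → (∀ j → j ∈ F → Fin (d j)) → Col d → Set
  Agrees F e J = ∀ j (p : j ∈ F) → e j p ≡ J j

  -- `agrees` tests each coordinate with a function local to its `where` block; it is named by unification.
  private
    agrees-test : ∀ {m} {d : Fin m → ℕ} (F : Subset m) (e : ∀ j → j ∈ F → Fin (d j)) (J : Col d) →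
                  Σ[ t ∈ (Fin m → Bool) ] agrees F e J ≡ foldr (λ j b → t j ∧ b) true (allFin m)
    agrees-test F e J = _ , refl

  agrees-reflects : ∀ {m} {d : Fin m → ℕ} (F : Subset m) (e : ∀ j → j ∈ F → Fin (d j)) (J : Col d) →
                    Reflects (Agrees F e J) (agrees F e J)
  agrees-reflects {m} F e J =
    Reflects-map (λ all j → tabulate⁻ all j) tabulate⁺ (foldr-∧-reflects test-reflects (allFin m))
    where
    test-reflects : ∀ j → Reflects (∀ p → e j p ≡ J j) (proj₁ (agrees-test F e J) j)
    test-reflects j with j ∈? F
    ... | yes p = subst (Reflects _) (≡.sym (isYes≗does (e j p ≟ J j)))
                    (Reflects-map (λ eq q → trans (∈-irrelevant-app e q p) eq) (λ h → h p) (proof (e j p ≟ J j)))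
    ... | no ¬p = ofʸ (λ p → contradiction p ¬p)

  complete : ∀ {m} {d : Fin m → ℕ} {F : Subset m} → Col d → (∀ j → j ∈ F → Fin (d j)) → Col d
  complete {F = F} default e j with j ∈? F
  ... | yes p = e j p
  ... | no _  = default j

  complete-∈ : ∀ {m} {d : Fin m → ℕ} {F : Subset m} (default : Col d) (e : ∀ j → j ∈ F → Fin (d j)) {j} (p : j ∈ F) →
               complete default e j ≡ e j p
  complete-∈ {F = F} default e {j} p with j ∈? F
  ... | yes q = ∈-irrelevant-app e q p
  ... | no ¬p = contradiction p ¬p

  incidence : ∀ {m} {C : Complex m} {d : Fin m → ℕ} → Row C d → Col d → Bool
  incidence (F , _ , e) = agrees F e

module IncidenceAction {c ℓ : Level} (R : CommutativeRing c ℓ) where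

  open CommutativeRing R using (Carrier; _≈_; _*_; *-congʳ)
  open ListSum R using (∑; 𝟙; ∑-cong)
  open Agreement using (incidence)

  -- Over ℤ, `𝟙 (incidence r j)` is definitionally `matA K e r j`.
  A⟨_,_⟩ : ∀ {m} (K : Complex m) (e : Fin m → ℕ) → (Col e → Carrier) → Row K e → Carrier
  A⟨_,_⟩ {m} K e w r = ∑[ j ∈ allCols m e ] (w j * 𝟙 (incidence r j))

  A-cong : ∀ {m} {K : Complex m} {e : Fin m → ℕ} {w w′ : Col e → Carrier} →
           (∀ j → w j ≈ w′ j) → ∀ r → A⟨ K , e ⟩ w r ≈ A⟨ K , e ⟩ w′ r
  A-cong {m} {e = e} w≈w′ r = ∑-cong (allCols m e) (λ j → *-congʳ (w≈w′ j))

module SubsetInsertion where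

  open import Data.Fin using (punchIn; punchOut)
  open import Data.Fin.Properties using (punchIn-punchOut; punchOut-punchIn; punchInᵢ≢i)
  open import Data.Fin.Subset using (Subset; _∈_; Side; inside)
  open import Data.Vec using (Vec; lookup; insertAt; removeAt)
  open import Data.Vec.Properties using ([]=⇒lookup; lookup⇒[]=; insertAt-lookup; insertAt-punchIn; removeAt-punchOut; insertAt-removeAt)
  open ≡ using (refl; cong; subst; trans; sym)

  data PunchInView {n} (v : Fin (suc n)) : Fin (suc n) → Set where
    at      : PunchInView v v
    punched : ∀ k → PunchInView v (punchIn v k)

  punchInView : ∀ {n} (v j : Fin (suc n)) → PunchInView v j
  punchInView v j with v ≟ j
  ... | yes refl = at
  ... | no v≢j   = subst (PunchInView v) (punchIn-punchOut v≢j) (punched (punchOut v≢j))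

  removeAt-punchIn : ∀ {n} {A : Set} (xs : Vec A (suc n)) v k → lookup (removeAt xs v) k ≡ lookup xs (punchIn v k)
  removeAt-punchIn xs v k = trans (cong (lookup (removeAt xs v)) (sym (punchOut-punchIn v)))
                                  (removeAt-punchOut xs (punchInᵢ≢i v k ∘ sym))

  module _ {n} (v : Fin (suc n)) where

    ∈-insertAt-self : ∀ (G : Subset n) → v ∈ insertAt G v inside
    ∈-insertAt-self G = lookup⇒[]= v _ (insertAt-lookup G v inside)

    ∈-insertAt⁺ : ∀ {G : Subset n} {s : Side} {k} → k ∈ G → punchIn v k ∈ insertAt G v s
    ∈-insertAt⁺ {G} {s} {k} k∈G = lookup⇒[]= (punchIn v k) _ (trans (insertAt-punchIn G v s k) ([]=⇒lookup k∈G))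

    ∈-insertAt⁻ : ∀ {G : Subset n} {s : Side} {k} → punchIn v k ∈ insertAt G v s → k ∈ G
    ∈-insertAt⁻ {G} {s} {k} p = lookup⇒[]= k G (trans (sym (insertAt-punchIn G v s k)) ([]=⇒lookup p))

    ∈-removeAt⁺ : ∀ {F : Subset (suc n)} {k} → punchIn v k ∈ F → k ∈ removeAt F v
    ∈-removeAt⁺ {F} {k} p = lookup⇒[]= k _ (trans (removeAt-punchIn F v k) ([]=⇒lookup p))

    ∈-removeAt⁻ : ∀ {F : Subset (suc n)} {k} → k ∈ removeAt F v → punchIn v k ∈ F
    ∈-removeAt⁻ {F} {k} p = lookup⇒[]= (punchIn v k) F (trans (sym (removeAt-punchIn F v k)) ([]=⇒lookup p))

    insertAt-removeAt-∈ : ∀ {F : Subset (suc n)} → v ∈ F → insertAt (removeAt F v) v inside ≡ F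
    insertAt-removeAt-∈ {F} v∈F = subst (λ s → insertAt (removeAt F v) v s ≡ F) ([]=⇒lookup v∈F) (insertAt-removeAt F v)

module LinkFacets {n} (C : Complex (suc n)) (v : Fin (suc n)) where

  open import Data.Fin.Subset using (_∈_; _⊆_; inside)
  open import Data.Vec using (insertAt; removeAt)
  open SubsetInsertion
  open ≡ using (subst; sym)

  IsFacet-insertAt : ∀ {G} → IsFacet (link C v) G → IsFacet C (insertAt G v inside)
  IsFacet-insertAt {G} (G∈L , G-maximal) = G∈L , maximal
    where
    maximal : ∀ H → insertAt G v inside ⊆ H → C H ≡ true → H ⊆ insertAt G v inside
    maximal H G+v⊆H H∈C {j} j∈H with punchInView v j
    ... | at        = ∈-insertAt-self v G
    ... | punched k = ∈-insertAt⁺ v (G-maximal (removeAt H v) G⊆H-v H-v∈L (∈-removeAt⁺ v j∈H))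
      where
      H-v∈L : link C v (removeAt H v) ≡ true
      H-v∈L = subst (λ X → C X ≡ true) (sym (insertAt-removeAt-∈ v (G+v⊆H (∈-insertAt-self v G)))) H∈C
      G⊆H-v : G ⊆ removeAt H v
      G⊆H-v k∈G = ∈-removeAt⁺ v (G+v⊆H (∈-insertAt⁺ v k∈G))

  IsFacet-removeAt : ∀ {F} → IsFacet C F → v ∈ F → IsFacet (link C v) (removeAt F v)
  IsFacet-removeAt {F} (F∈C , F-maximal) v∈F = F-v∈L , maximal
    where
    F-v∈L : link C v (removeAt F v) ≡ true
    F-v∈L = subst (λ X → C X ≡ true) (sym (insertAt-removeAt-∈ v v∈F)) F∈C
    maximal : ∀ G → removeAt F v ⊆ G → link C v G ≡ true → G ⊆ removeAt F v
    maximal G F-v⊆G G∈L k∈G = ∈-removeAt⁺ v (F-maximal (insertAt G v inside) F⊆G+v G∈L (∈-insertAt⁺ v k∈G))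
      where
      F⊆G+v : F ⊆ insertAt G v inside
      F⊆G+v {j} j∈F with punchInView v j
      ... | at        = ∈-insertAt-self v G
      ... | punched k = ∈-insertAt⁺ v (F-v⊆G (∈-removeAt⁺ v j∈F))

module LinkRows {n} (C : Complex (suc n)) (d : Fin (suc n) → ℕ) (v : Fin (suc n)) where

  open import Data.Fin.Subset using (_∈_; _∉_; inside)
  open import Data.Product using (_×_)
  open import Data.Vec using (insertAt; removeAt)
  open import Relation.Nullary using (proof)
  open import Relation.Nullary.Reflects using (_×-reflects_; det)
  open Agreement
  open Columns
  open LinkFacets C v
  open SubsetInsertion
  open ≡ using (sym; trans)
  open ≡.≡-Reasoning

  up : Fin (d v) → Col (deleteAt d v) → Row (link C v) (deleteAt d v) → Row C d
  up a default (G , G-facet , e) = insertAt G v inside , IsFacet-insertAt G-facet , λ j _ → insertCol d v a (complete default e) j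

  down : (r : Row C d) → v ∈ proj₁ r → Row (link C v) (deleteAt d v)
  down (F , F-facet , e) v∈F = removeAt F v , IsFacet-removeAt F-facet v∈F , λ k p → e (punchIn v k) (∈-removeAt⁻ v p)

  valueAt-v : (r : Row C d) → v ∈ proj₁ r → Fin (d v)
  valueAt-v (F , _ , e) v∈F = e v v∈F

  incidence-up : ∀ a default rL b i →
                 incidence (up a default rL) (insertCol d v b i) ≡ (does (b ≟ a) ∧ incidence rL i)
  incidence-up a default (G , _ , e) b i =
    det (agrees-reflects _ _ _) (Reflects-map to from (proof (b ≟ a) ×-reflects agrees-reflects G e i))
    where
    e↑ = complete default e
    to : b ≡ a × Agrees G e i → Agrees (insertAt G v inside) (λ j _ → insertCol d v a e↑ j) (insertCol d v b i)
    to (b≡a , agree) j p with punchInView v j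
    ... | at = begin
      insertCol d v a e↑ v ≡⟨ insertCol-self d v a e↑ ⟩
      a                    ≡⟨ sym b≡a ⟩
      b                    ≡⟨ insertCol-self d v b i ⟨
      insertCol d v b i v  ∎
    ... | punched k = begin
      insertCol d v a e↑ (punchIn v k) ≡⟨ insertCol-punchIn d v a e↑ k ⟩
      e↑ k                             ≡⟨ complete-∈ default e (∈-insertAt⁻ v p) ⟩
      e k (∈-insertAt⁻ v p)            ≡⟨ agree k (∈-insertAt⁻ v p) ⟩
      i k                              ≡⟨ insertCol-punchIn d v b i k ⟨
      insertCol d v b i (punchIn v k)  ∎
    from : Agrees (insertAt G v inside) (λ j _ → insertCol d v a e↑ j) (insertCol d v b i) → b ≡ a × Agrees G e i
    from agree = b≡a , agree′
      where
      b≡a = begin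
        b                    ≡⟨ insertCol-self d v b i ⟨
        insertCol d v b i v  ≡⟨ agree v (∈-insertAt-self v G) ⟨
        insertCol d v a e↑ v ≡⟨ insertCol-self d v a e↑ ⟩
        a                    ∎
      agree′ : Agrees G e i
      agree′ k p = begin
        e k p                            ≡⟨ complete-∈ default e p ⟨
        e↑ k                             ≡⟨ insertCol-punchIn d v a e↑ k ⟨
        insertCol d v a e↑ (punchIn v k) ≡⟨ agree (punchIn v k) (∈-insertAt⁺ v p) ⟩
        insertCol d v b i (punchIn v k)  ≡⟨ insertCol-punchIn d v b i k ⟩
        i k                              ∎

  incidence-down : ∀ (r : Row C d) (v∈F : v ∈ proj₁ r) b i →
                   incidence r (insertCol d v b i) ≡ (does (b ≟ valueAt-v r v∈F) ∧ incidence (down r v∈F) i)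
  incidence-down r@(F , _ , e) v∈F b i =
    det (agrees-reflects _ _ _) (Reflects-map to from (proof (b ≟ e v v∈F) ×-reflects agrees-reflects _ _ i))
    where
    e↓ = λ k p → e (punchIn v k) (∈-removeAt⁻ v p)
    to : b ≡ e v v∈F × Agrees (removeAt F v) e↓ i → Agrees F e (insertCol d v b i)
    to (b≡eᵥ , agree) j p with punchInView v j
    ... | at = begin
      e v p               ≡⟨ ∈-irrelevant-app e p v∈F ⟩
      e v v∈F             ≡⟨ sym b≡eᵥ ⟩
      b                   ≡⟨ insertCol-self d v b i ⟨
      insertCol d v b i v ∎
    ... | punched k = begin
      e (punchIn v k) p               ≡⟨ ∈-irrelevant-app e p _ ⟩
      e↓ k (∈-removeAt⁺ v p)          ≡⟨ agree k (∈-removeAt⁺ v p) ⟩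
      i k                             ≡⟨ insertCol-punchIn d v b i k ⟨
      insertCol d v b i (punchIn v k) ∎
    from : Agrees F e (insertCol d v b i) → b ≡ e v v∈F × Agrees (removeAt F v) e↓ i
    from agree = trans (sym (insertCol-self d v b i)) (sym (agree v v∈F)) ,
                 λ k p → trans (agree (punchIn v k) (∈-removeAt⁻ v p)) (insertCol-punchIn d v b i k)

  incidence-avoid : ∀ (r : Row C d) → v ∉ proj₁ r → ∀ b b′ i →
                    incidence r (insertCol d v b i) ≡ incidence r (insertCol d v b′ i)
  incidence-avoid r@(F , _ , e) v∉F b b′ i =
    det (agrees-reflects F e _) (Reflects-map (transfer b b′) (transfer b′ b) (agrees-reflects F e (insertCol d v b′ i)))
    where
    transfer : ∀ b b′ → Agrees F e (insertCol d v b′ i) → Agrees F e (insertCol d v b i)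
    transfer b b′ agree j p with punchInView v j
    ... | at        = contradiction p v∉F
    ... | punched k = trans (agree _ p) (trans (insertCol-punchIn d v b′ i k) (sym (insertCol-punchIn d v b i k)))

module Lift {c ℓ : Level} (R : CommutativeRing c ℓ) {n} (d : Fin (suc n) → ℕ) (v : Fin (suc n))
            {a₀ a₁ : Fin (d v)} (a₀≢a₁ : a₀ ≢ a₁) where

  open CommutativeRing R hiding (zero)
  open ListSum R
  open ColumnSum R
  open Split R a₀≢a₁
  open Columns
  import Data.List.Relation.Unary.All as All
  open import Relation.Binary.Reasoning.Setoid setoid

  private
    cols  = allCols (suc n) d
    cols′ = allCols n (deleteAt d v)

  lift : (Col (deleteAt d v) → Carrier) → (Col (deleteAt d v) → Carrier) → Col d → Carrier
  lift u P j = split (j v) (u (canonical (deleteCol v j))) (P (canonical (deleteCol v j)))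

  lift-insertCol : ∀ u P b → All (λ i → lift u P (insertCol d v b i) ≡ split b (u i) (P i)) cols′
  lift-insertCol u P b = All.map (λ {i} κi≡i → ≡.cong₂ (λ b′ i′ → split b′ (u i′) (P i′))
                                                  (insertCol-self d v b i)
                                                  (≡.trans (canonical-deleteCol-insertCol d v b i) κi≡i))
                                 (canonical-allCols n (deleteAt d v))

  lift-a₀ : ∀ u P → All (λ i → lift u P (insertCol d v a₀ i) ≡ u i) cols′
  lift-a₀ u P = All.map (λ {i} eq → ≡.trans eq (split-a₀ (u i) (P i))) (lift-insertCol u P a₀)

  ∑-lift-through : ∀ (hit : Col d → Bool) (hit′ : Col (deleteAt d v) → Bool) β →
                   (∀ b i → hit (insertCol d v b i) ≡ (does (b ≟ β) ∧ hit′ i)) →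
                   ∀ u P → ∑[ j ∈ cols ] (lift u P j * 𝟙 (hit j)) ≈
                           split β (∑[ i ∈ cols′ ] (u i * 𝟙 (hit′ i))) (∑[ i ∈ cols′ ] (P i * 𝟙 (hit′ i)))
  ∑-lift-through hit hit′ β hit≡ u P = begin
    ∑[ j ∈ cols ] (lift u P j * 𝟙 (hit j))
      ≈⟨ ∑-slice d v hit hit′ β hit≡ (lift u P) ⟩
    ∑[ i ∈ cols′ ] (lift u P (insertCol d v β i) * 𝟙 (hit′ i))
      ≈⟨ ∑-congᴬ (All.map (λ eq → *-congʳ (reflexive eq)) (lift-insertCol u P β)) ⟩
    ∑[ i ∈ cols′ ] (split β (u i) (P i) * 𝟙 (hit′ i))
      ≈⟨ ∑-split-* cols′ β u P (𝟙 ∘ hit′) ⟩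
    split β (∑[ i ∈ cols′ ] (u i * 𝟙 (hit′ i))) (∑[ i ∈ cols′ ] (P i * 𝟙 (hit′ i))) ∎

  ∑-lift-avoid : ∀ (hit : Col d → Bool) → (∀ b b′ i → hit (insertCol d v b i) ≡ hit (insertCol d v b′ i)) →
                 ∀ u P → ∑[ j ∈ cols ] (lift u P j * 𝟙 (hit j)) ≈ ∑[ i ∈ cols′ ] (P i * 𝟙 (hit (insertCol d v a₀ i)))
  ∑-lift-avoid hit hit≡ u P = begin
    ∑[ j ∈ cols ] (lift u P j * 𝟙 (hit j))
      ≈⟨ ∑-allCols-insertCol n d v _ ⟩
    ∑[ b ∈ allFin (d v) ] ∑[ i ∈ cols′ ] (lift u P (insertCol d v b i) * 𝟙 (hit (insertCol d v b i)))
      ≈⟨ ∑-cong (allFin (d v)) (λ b → ∑-congᴬ (All.map (λ {i} eq → *-cong (reflexive eq) (reflexive (≡.cong 𝟙 (hit≡ b a₀ i))))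
                                                        (lift-insertCol u P b))) ⟩
    ∑[ b ∈ allFin (d v) ] ∑[ i ∈ cols′ ] (split b (u i) (P i) * 𝟙 (hit (insertCol d v a₀ i)))
      ≈⟨ ∑-comm (allFin (d v)) cols′ _ ⟩
    ∑[ i ∈ cols′ ] ∑[ b ∈ allFin (d v) ] (split b (u i) (P i) * 𝟙 (hit (insertCol d v a₀ i)))
      ≈⟨ ∑-cong cols′ (λ i → *-distribʳ-∑ (allFin (d v)) _ _) ⟨
    ∑[ i ∈ cols′ ] (∑[ b ∈ allFin (d v) ] split b (u i) (P i) * 𝟙 (hit (insertCol d v a₀ i)))
      ≈⟨ ∑-cong cols′ (λ i → *-congʳ (∑-split (u i) (P i))) ⟩
    ∑[ i ∈ cols′ ] (P i * 𝟙 (hit (insertCol d v a₀ i))) ∎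

module LinkLift {c ℓ : Level} (R : CommutativeRing c ℓ) {n} (C : Complex (suc n)) (d : Fin (suc n) → ℕ)
                (v : Fin (suc n)) {a₀ a₁ : Fin (d v)} (a₀≢a₁ : a₀ ≢ a₁) where

  open CommutativeRing R hiding (zero)
  open ListSum R
  open Split R a₀≢a₁
  open Lift R d v a₀≢a₁
  open LinkRows C d v
  open Agreement using (incidence)
  open IncidenceAction R
  open import Data.Fin.Subset.Properties using (_∈?_)
  open import Relation.Binary.Reasoning.Setoid setoid

  private
    L  = link C v
    d′ = deleteAt d v

  lift-cong : ∀ u u′ P → (∀ rL → A⟨ L , d′ ⟩ u rL ≈ A⟨ L , d′ ⟩ u′ rL) →
              ∀ r → A⟨ C , d ⟩ (lift u P) r ≈ A⟨ C , d ⟩ (lift u′ P) r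
  lift-cong u u′ P Au≈Au′ r with v ∈? proj₁ r
  ... | yes v∈F = begin
    A⟨ C , d ⟩ (lift u P) r                        ≈⟨ through u ⟩
    split β (A⟨ L , d′ ⟩ u rL) (A⟨ L , d′ ⟩ P rL)  ≈⟨ split-cong β _ (Au≈Au′ rL) ⟩
    split β (A⟨ L , d′ ⟩ u′ rL) (A⟨ L , d′ ⟩ P rL) ≈⟨ through u′ ⟨
    A⟨ C , d ⟩ (lift u′ P) r                       ∎
    where
    β = valueAt-v r v∈F
    rL = down r v∈F
    through = λ w → ∑-lift-through (incidence r) (incidence rL) β (incidence-down r v∈F) w P
  ... | no v∉F = trans (∑-lift-avoid (incidence r) (incidence-avoid r v∉F) u P)
                       (sym (∑-lift-avoid (incidence r) (incidence-avoid r v∉F) u′ P))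

module IntegerToRational where

  open import Data.Integer using (ℤ; +_; -[1+_]; +[1+_])
  import Data.Integer as ℤ
  import Data.Integer.Properties as ℤ
  open import Data.Nat.Coprimality using (1-coprimeTo)
  import Data.Nat.Coprimality as Coprime
  open import Data.Rational using (ℚ; mkℚ; 0ℚ; ↥_; *≤*)
  import Data.Rational as ℚ
  import Data.Rational.Properties as ℚ
  open import Data.Nat using (s≤s; z≤n)
  open Agreement using (incidence)
  open ≡ using (refl; cong; cong₂; trans; sym; subst)

  ℤ-ring = ℤ.+-*-commutativeRing
  ℚ-ring = ℚ.+-*-commutativeRing
  module ∑ℤ = ListSum ℤ-ring
  module ∑ℚ = ListSum ℚ-ring
  module ℤA = IncidenceAction ℤ-ring
  module ℚA = IncidenceAction ℚ-ring

  -- `toℚ z = z / 1` goes through normalisation; on `fromℤ z`, already normalised, ℚ arithmetic computes.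
  private
    fromℤ : ℤ → ℚ
    fromℤ z = mkℚ z 0 (Coprime.sym (1-coprimeTo ℤ.∣ z ∣))

    toℚ≡fromℤ : ∀ z → toℚ z ≡ fromℤ z
    toℚ≡fromℤ z = ℚ.↥p/↧p≡p (fromℤ z)

  toℚ-+ : ∀ a b → toℚ (a ℤ.+ b) ≡ toℚ a ℚ.+ toℚ b
  toℚ-+ a b = sym (trans (cong₂ ℚ._+_ (toℚ≡fromℤ a) (toℚ≡fromℤ b))
                         (cong₂ (λ x y → (x ℤ.+ y) ℚ./ 1) (ℤ.*-identityʳ a) (ℤ.*-identityʳ b)))

  toℚ-* : ∀ a b → toℚ (a ℤ.* b) ≡ toℚ a ℚ.* toℚ b
  toℚ-* a b = sym (cong₂ ℚ._*_ (toℚ≡fromℤ a) (toℚ≡fromℤ b))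

  toℚ-neg : ∀ a → toℚ (ℤ.- a) ≡ ℚ.- toℚ a
  toℚ-neg a = trans (toℚ≡fromℤ (ℤ.- a)) (trans (fromℤ-neg a) (cong ℚ.-_ (sym (toℚ≡fromℤ a))))
    where
    fromℤ-neg : ∀ a → fromℤ (ℤ.- a) ≡ ℚ.- fromℤ a
    fromℤ-neg (+ 0)    = refl
    fromℤ-neg +[1+ n ] = refl
    fromℤ-neg -[1+ n ] = refl

  toℚ-sub : ∀ a b → toℚ (a ℤ.- b) ≡ toℚ a ℚ.- toℚ b
  toℚ-sub a b = trans (toℚ-+ a (ℤ.- b)) (cong (toℚ a ℚ.+_) (toℚ-neg b))

  toℚ-𝟙 : ∀ b → toℚ (∑ℤ.𝟙 b) ≡ ∑ℚ.𝟙 b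
  toℚ-𝟙 false = refl
  toℚ-𝟙 true  = refl

  toℚ-∑ : ∀ {I : Set} (xs : List I) (f : I → ℤ) → toℚ (∑ℤ.∑ xs f) ≡ ∑ℚ.∑ xs (toℚ ∘ f)
  toℚ-∑ []       f = refl
  toℚ-∑ (x ∷ xs) f = trans (toℚ-+ (f x) _) (cong (toℚ (f x) ℚ.+_) (toℚ-∑ xs f))

  toℚ-A : ∀ {m} {K : Complex m} {e : Fin m → ℕ} (w : Col e → ℤ) r →
          toℚ (ℤA.A⟨ K , e ⟩ w r) ≡ ℚA.A⟨ K , e ⟩ (toℚ ∘ w) r
  toℚ-A {m} {e = e} w r = trans (toℚ-∑ (allCols m e) _)
    (∑ℚ.∑-cong (allCols m e) (λ j → trans (toℚ-* (w j) _) (cong (toℚ (w j) ℚ.*_) (toℚ-𝟙 (incidence r j)))))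

  ∑-toℚ-matA : ∀ {m} {K : Complex m} {e : Fin m → ℕ} (q : Col e → ℚ) r →
               sumℚ (map (λ j → q j ℚ.* toℚ (matA K e r j)) (allCols m e)) ≡ ℚA.A⟨ K , e ⟩ q r
  ∑-toℚ-matA {m} {e = e} q r = ∑ℚ.∑-cong (allCols m e) (λ j → cong (q j ℚ.*_) (toℚ-𝟙 (incidence r j)))

  ≤-toℚ-↥ : ∀ q → 0ℚ ℚ.≤ q → q ℚ.≤ toℚ (↥ q)
  ≤-toℚ-↥ q@(mkℚ (+ k) _ _) _ rewrite toℚ≡fromℤ (+ k) = *≤* (ℤ.*-monoˡ-≤-nonNeg (+ k) (ℤ.+≤+ (s≤s z≤n)))
  ≤-toℚ-↥ (mkℚ -[1+ k ] _ _) (*≤* ())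

  p≤q⇒0≤q-p : ∀ {p q} → p ℚ.≤ q → 0ℚ ℚ.≤ q ℚ.- p
  p≤q⇒0≤q-p {p} {q} p≤q = subst (ℚ._≤ q ℚ.- p) (ℚ.+-inverseʳ p) (ℚ.+-monoˡ-≤ (ℚ.- p) p≤q)

module LinkNormality {n} (C : Complex (suc n)) (d : Fin (suc n) → ℕ) (v : Fin (suc n))
                     {a₀ a₁ : Fin (d v)} (a₀≢a₁ : a₀ ≢ a₁) (default : Col (deleteAt d v)) where

  open import Data.Integer using (ℤ)
  import Data.Integer as ℤ
  open import Data.Rational using (ℚ; 0ℚ; ↥_)
  import Data.Rational as ℚ
  import Data.Rational.Properties as ℚ
  import Data.List.Relation.Unary.All as All
  open IntegerToRational
  open Agreement using (incidence)
  open LinkRows C d v using (up; incidence-up)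
  open Columns using (insertCol)
  open IncidenceAction ℤ-ring public using (A⟨_,_⟩)
  module ℤS = Split ℤ-ring a₀≢a₁
  module ℚS = Split ℚ-ring a₀≢a₁
  module ℤL = Lift ℤ-ring d v a₀≢a₁
  module ℚL = Lift ℚ-ring d v a₀≢a₁
  open ≡ using (refl; cong; trans)
  open ≡.≡-Reasoning

  private
    L  = link C v
    d′ = deleteAt d v

  A-up : ∀ (w : Col d → ℤ) rL → A⟨ C , d ⟩ w (up a₀ default rL) ≡ A⟨ L , d′ ⟩ (w ∘ insertCol d v a₀) rL
  A-up w rL = ColumnSum.∑-slice ℤ-ring d v (incidence (up a₀ default rL)) (incidence rL) a₀ (incidence-up a₀ default rL) w

  A-lift-up : ∀ u P rL → A⟨ C , d ⟩ (ℤL.lift u P) (up a₀ default rL) ≡ A⟨ L , d′ ⟩ u rL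
  A-lift-up u P rL = trans (A-up (ℤL.lift u P) rL) (∑ℤ.∑-congᴬ (All.map (cong (ℤ._* _)) (ℤL.lift-a₀ u P)))

  toℚ-split : ∀ b X P → toℚ (ℤS.split b X P) ≡ ℚS.split b (toℚ X) (toℚ P)
  toℚ-split b X P with b ≟ a₀ | b ≟ a₁
  ... | yes _ | _     = refl
  ... | no _  | yes _ = toℚ-sub P X
  ... | no _  | no _  = refl

  split-nonneg : ∀ b {X P} → 0ℚ ℚ.≤ X → X ℚ.≤ P → 0ℚ ℚ.≤ ℚS.split b X P
  split-nonneg b 0≤X X≤P with b ≟ a₀ | b ≟ a₁
  ... | yes _ | _     = 0≤X
  ... | no _  | yes _ = p≤q⇒0≤q-p X≤P
  ... | no _  | no _  = ℚ.≤-refl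

  A-lift-inCone : ∀ (x : Row L d′ → ℤ) c q → (∀ i → 0ℚ ℚ.≤ q i) → (∀ rL → x rL ≡ A⟨ L , d′ ⟩ c rL) →
                  (∀ rL → toℚ (x rL) ≡ sumℚ (map (λ i → q i ℚ.* toℚ (matA L d′ rL i)) (allCols n d′))) →
                  InCone (allCols (suc n) d) (matA C d) (A⟨ C , d ⟩ (ℤL.lift c (↥_ ∘ q)))
  A-lift-inCone x c q q≥0 x≡Ac x≡Aq = ℚL.lift q P , (λ j → split-nonneg (j v) (q≥0 _) (≤-toℚ-↥ _ (q≥0 _))) , λ r → begin
    toℚ (A⟨ C , d ⟩ (ℤL.lift c (↥_ ∘ q)) r)          ≡⟨ toℚ-A (ℤL.lift c (↥_ ∘ q)) r ⟩
    ℚA.A⟨ C , d ⟩ (toℚ ∘ ℤL.lift c (↥_ ∘ q)) r       ≡⟨ ℚA.A-cong (λ j → toℚ-split (j v) _ _) r ⟩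
    ℚA.A⟨ C , d ⟩ (ℚL.lift (toℚ ∘ c) P) r            ≡⟨ LinkLift.lift-cong ℚ-ring C d v a₀≢a₁ (toℚ ∘ c) q P c≡q r ⟩
    ℚA.A⟨ C , d ⟩ (ℚL.lift q P) r                    ≡⟨ ∑-toℚ-matA (ℚL.lift q P) r ⟨
    sumℚ (map (λ j → ℚL.lift q P j ℚ.* toℚ (matA C d r j)) (allCols (suc n) d)) ∎
    where
    P = λ i → toℚ (↥ q i)
    c≡q : ∀ rL → ℚA.A⟨ L , d′ ⟩ (toℚ ∘ c) rL ≡ ℚA.A⟨ L , d′ ⟩ q rL
    c≡q rL = begin
      ℚA.A⟨ L , d′ ⟩ (toℚ ∘ c) rL ≡⟨ toℚ-A c rL ⟨
      toℚ (A⟨ L , d′ ⟩ c rL)      ≡⟨ cong toℚ (x≡Ac rL) ⟨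
      toℚ (x rL)                  ≡⟨ x≡Aq rL ⟩
      _                           ≡⟨ ∑-toℚ-matA q rL ⟩
      ℚA.A⟨ L , d′ ⟩ q rL         ∎

two-distinct : ∀ {m} → 2 ≤ m → Σ[ a ∈ Fin m ] Σ[ b ∈ Fin m ] a ≢ b
two-distinct (s≤s (s≤s _)) = zero , suc zero , λ ()

theorem4p10 : (n : ℕ) (C : Complex (suc n)) → IsSimplicialComplex C →
    (d : Fin (suc n) → ℕ) → (∀ j → 2 ≤ d j) → NormalA C d →
    (v : Fin (suc n)) → C ⁅ v ⁆ ≡ true →
    NormalA (link C v) (deleteAt d v)
theorem4p10 n C _ d 2≤d normal v _ x (c , x≡Ac) (q , q≥0 , x≡Aq) with two-distinct (2≤d v)
... | a₀ , _ , a₀≢a₁ = N ∘ insertCol d v a₀ , x≡AN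
  where
  open Columns using (insertCol)
  open LinkRows C d v using (up)
  open LinkNormality C d v a₀≢a₁ (λ k → proj₁ (two-distinct (2≤d (punchIn v k))))
  open ≡.≡-Reasoning
  P = ↥_ ∘ q
  y∈ℕA = normal (A⟨ C , d ⟩ (ℤL.lift c P)) (ℤL.lift c P , λ _ → ≡.refl) (A-lift-inCone x c q q≥0 x≡Ac x≡Aq)
  N = proj₁ y∈ℕA
  x≡AN : ∀ rL → x rL ≡ A⟨ link C v , deleteAt d v ⟩ (+_ ∘ N ∘ insertCol d v a₀) rL
  x≡AN rL = begin
    x rL                                                ≡⟨ x≡Ac rL ⟩
    A⟨ link C v , deleteAt d v ⟩ c rL                   ≡⟨ A-lift-up c P rL ⟨
    A⟨ C , d ⟩ (ℤL.lift c P) (up a₀ _ rL)               ≡⟨ proj₂ y∈ℕA (up a₀ _ rL) ⟩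
    A⟨ C , d ⟩ (+_ ∘ N) (up a₀ _ rL)                    ≡⟨ A-up (+_ ∘ N) rL ⟩
    A⟨ link C v , deleteAt d v ⟩ (+_ ∘ N ∘ insertCol d v a₀) rL ∎
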